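{- Let $r\geq3$, let $D$ be an $m$-colored semicomplete $r$-partite digraph, let $k\in\{2,3\}$ and let $x,y\in V(D)$. If there exists a $k$-colored directed path from $x$ to $y$ and there does not exist a $k'$-colored directed path from $y$ to $x$ with $k'\leq k$, then $d(x,y)\leq 4$.
   Context: A digraph is $m$-colored if each arc is assigned one of $m$ colors. A semicomplete $r$-partite digraph is obtained from a complete $r$-partite graph by replacing each edge $uv$ by the arc $(u,v)$, the arc $(v,u)$, or both; no arcs join vertices of the same part. A directed path is $j$-colored if its arcs use exactly $j$ distinct colors. $d(x,y)$ denotes the minimum number of arcs of a directed path from $x$ to $y$. -}

module Defs where

open import Data.Nat using (ℕ; zero; suc)
open import Data.Fin using (Fin)
open import Data.Fin.Properties using (_≟_)
open import Data.List using (List; []; _∷_; length; deduplicate)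
open import Data.List.Relation.Unary.Unique.Propositional using (Unique)
open import Data.Product using (Σ; _×_)
open import Data.Sum using (_⊎_)
open import Relation.Binary.PropositionalEquality using (_≡_; _≢_)

record ColoredDigraph (n m : ℕ) : Set₁ where
  field
    Arc : Fin n → Fin n → Set
    color : {u v : Fin n} → Arc u v → Fin m

module _ {n m : ℕ} (D : ColoredDigraph n m) where
  open ColoredDigraph D

  record IsSemicompleteMultipartite (r : ℕ) (part : Fin n → Fin r) : Set where
    field
      partsNonempty : (i : Fin r) → Σ (Fin n) (λ u → part u ≡ i)
      noArcInPart : {u v : Fin n} → Arc u v → part u ≢ part v
      semicomplete : (u v : Fin n) → part u ≢ part v → Arc u v ⊎ Arc v u

  data Walk : Fin n → Fin n → Set where
    [] : {x : Fin n} → Walk x x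
    _∷_ : {x y z : Fin n} → Arc x y → Walk y z → Walk x z

  vertices : {x y : Fin n} → Walk x y → List (Fin n)
  vertices {x} [] = x ∷ []
  vertices {x} (a ∷ w) = x ∷ vertices w

  arcCount : {x y : Fin n} → Walk x y → ℕ
  arcCount [] = zero
  arcCount (a ∷ w) = suc (arcCount w)

  arcColors : {x y : Fin n} → Walk x y → List (Fin m)
  arcColors [] = []
  arcColors (a ∷ w) = color a ∷ arcColors w

  numColors : {x y : Fin n} → Walk x y → ℕ
  numColors w = length (deduplicate _≟_ (arcColors w))

  IsPath : {x y : Fin n} → Walk x y → Set
  IsPath w = Unique (vertices w)

  HasColoredPath : ℕ → Fin n → Fin n → Set
  HasColoredPath j x y = Σ (Walk x y) (λ w → IsPath w × numColors w ≡ j)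

  DistAtMost : Fin n → Fin n → ℕ → Set
  DistAtMost x y l = Σ (Walk x y) (λ w → IsPath w × Data.Nat._≤_ (arcCount w) l)

module Submission where

-- Only short walks matter: a walk y ⇝ x with at most two arcs
-- would contain a directed path with at most two arcs, hence with at most
-- two ≤ k colours, which the hypothesis forbids.  So (after loop erasure)
-- y has no walk to x of length ≤ 2.
--
-- If x and y lie in different parts, semicompleteness and the absence of
-- the arc y → x give the arc x → y.  Otherwise let P be the common part.
-- Every vertex w outside P satisfies w → y or x → w, since y → w → x is
-- forbidden.  Following a walk x → u ⇝ y with u an out-neighbour of x, the
-- vertex after u either lies outside P (then it is an out-neighbour of x,
-- or it reaches y in one arc), or lies in P and is y itself, or is followed
-- by a vertex outside P (to which the same dichotomy applies).  Either we
-- find a walk of length ≤ 4 to y or we advance to a later out-neighbour of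
-- x; the walk is finite, so the first case happens.

open import Defs
open import Data.Nat using (ℕ; _≤_; z≤n; s≤s)
open import Data.Nat.Properties using (≤-refl; ≤-trans; m≤n⇒m≤1+n)
open import Data.Fin using (Fin)
open import Data.Fin.Properties using (_≟_)
open import Data.List using (length)
open import Data.List.Properties using (length-deduplicate)
open import Data.List.Relation.Unary.Any using (here; there)
open import Data.List.Relation.Unary.All.Properties using (¬Any⇒All¬)
open import Data.List.Relation.Unary.All using ([])
open import Data.List.Relation.Unary.AllPairs using ([]; _∷_)
open import Data.List.Membership.Propositional using (_∈_)
import Data.List.Membership.DecPropositional as DecMembership
open import Data.Sum using (_⊎_; inj₁; inj₂)
open import Data.Product using (Σ; _×_; _,_)
open import Data.Empty using (⊥; ⊥-elim)
open import Relation.Nullary using (¬_; yes; no)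
open import Relation.Binary.PropositionalEquality using (_≡_; _≢_; refl; sym; trans)

module Walks {n m : ℕ} (D : ColoredDigraph n m) where
  open DecMembership (_≟_ {n}) using (_∈?_)

  ShortWalk : Fin n → Fin n → ℕ → Set
  ShortWalk x y l = Σ (Walk D x y) (λ w → arcCount D w ≤ l)

  dropTo : ∀ {x y z} (w : Walk D x y) → z ∈ vertices D w → Walk D z y
  dropTo []      (here refl) = []
  dropTo (a ∷ w) (here refl) = a ∷ w
  dropTo (a ∷ w) (there i)   = dropTo w i

  dropTo-arcCount : ∀ {x y z} (w : Walk D x y) (i : z ∈ vertices D w) →
                    arcCount D (dropTo w i) ≤ arcCount D w
  dropTo-arcCount []      (here refl) = z≤n
  dropTo-arcCount (a ∷ w) (here refl) = ≤-refl
  dropTo-arcCount (a ∷ w) (there i)   = m≤n⇒m≤1+n (dropTo-arcCount w i)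

  dropTo-isPath : ∀ {x y z} (w : Walk D x y) (i : z ∈ vertices D w) →
                  IsPath D w → IsPath D (dropTo w i)
  dropTo-isPath []      (here refl) p       = p
  dropTo-isPath (a ∷ w) (here refl) p       = p
  dropTo-isPath (a ∷ w) (there i)   (_ ∷ p) = dropTo-isPath w i p

  loopErase : ∀ {x y} (w : Walk D x y) →
              Σ (Walk D x y) (λ p → IsPath D p × arcCount D p ≤ arcCount D w)
  loopErase [] = [] , [] ∷ [] , z≤n
  loopErase {x} (a ∷ w) with loopErase w
  ... | p , isPath , p≤w with x ∈? vertices D p
  ...   | yes i = dropTo p i , dropTo-isPath p i isPath
                , ≤-trans (dropTo-arcCount p i) (m≤n⇒m≤1+n p≤w)
  ...   | no x∉p = a ∷ p , ¬Any⇒All¬ (vertices D p) x∉p ∷ isPath , s≤s p≤w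

  shortWalk⇒dist : ∀ {x y l} → ShortWalk x y l → DistAtMost D x y l
  shortWalk⇒dist (w , w≤l) with loopErase w
  ... | p , isPath , p≤w = p , isPath , ≤-trans p≤w w≤l

  numColors≤arcCount : ∀ {x y} (w : Walk D x y) → numColors D w ≤ arcCount D w
  numColors≤arcCount w = ≤-trans (length-deduplicate _≟_ (arcColors D w)) (length-arcColors w)
    where
    length-arcColors : ∀ {x y} (w : Walk D x y) → length (arcColors D w) ≤ arcCount D w
    length-arcColors []      = z≤n
    length-arcColors (a ∷ w) = s≤s (length-arcColors w)

  noShortWalk : ∀ {k x y} → ((k′ : ℕ) → k′ ≤ k → ¬ HasColoredPath D k′ y x) →
                (w : Walk D y x) → arcCount D w ≤ k → ⊥
  noShortWalk forbidden w w≤k with loopErase w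
  ... | p , isPath , p≤w =
    forbidden (numColors D p) (≤-trans (numColors≤arcCount p) (≤-trans p≤w w≤k))
              (p , isPath , refl)

module Multipartite {n m r : ℕ} (D : ColoredDigraph n m) (part : Fin n → Fin r)
  (S : IsSemicompleteMultipartite D r part) (x y : Fin n)
  (noShort : (w : Walk D y x) → arcCount D w ≤ 2 → ⊥) where
  open ColoredDigraph D
  open IsSemicompleteMultipartite S
  open Walks D

  -- A vertex outside the parts of x and y is dominated by x or dominates y,
  -- because y → w → x would be a forbidden walk of length 2.
  outsideDichotomy : ∀ {w} → part w ≢ part x → part w ≢ part y → Arc w y ⊎ Arc x w
  outsideDichotomy {w} w∉x w∉y with semicomplete w y w∉y
  ... | inj₁ wy = inj₁ wy
  ... | inj₂ yw with semicomplete x w (λ e → w∉x (sym e))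
  ...   | inj₁ xw = inj₂ xw
  ...   | inj₂ wx = ⊥-elim (noShort (yw ∷ wx ∷ []) ≤-refl)

  module SamePart (x∼y : part x ≡ part y) where

    outside : ∀ {w} → part w ≢ part x → Arc w y ⊎ Arc x w
    outside w∉x = outsideDichotomy w∉x (λ e → w∉x (trans e (sym x∼y)))

    -- Walk-following: from an out-neighbour u of x with a walk u ⇝ y we
    -- obtain a walk x ⇝ y of length ≤ 4.  Each recursive call moves to a
    -- later out-neighbour of x along the walk.
    fromOutNeighbour : ∀ {u} → Arc x u → Walk D u y → ShortWalk x y 4
    throughPart : ∀ {u v} → Arc x u → Arc u v → part v ≡ part x → Walk D v y →
                  ShortWalk x y 4

    fromOutNeighbour xu [] = xu ∷ [] , s≤s z≤n
    fromOutNeighbour xu (_∷_ {y = v} uv w) with part v ≟ part x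
    ... | yes v∼x = throughPart xu uv v∼x w
    ... | no  v≁x with outside v≁x
    ...   | inj₁ vy = xu ∷ uv ∷ vy ∷ [] , s≤s (s≤s (s≤s z≤n))
    ...   | inj₂ xv = fromOutNeighbour xv w

    throughPart xu uv v∼x [] = xu ∷ uv ∷ [] , s≤s (s≤s z≤n)
    throughPart xu uv v∼x (vt ∷ w) with outside (λ t∼x → noArcInPart vt (trans v∼x (sym t∼x)))
    ... | inj₁ ty = xu ∷ uv ∷ vt ∷ ty ∷ [] , ≤-refl
    ... | inj₂ xt = fromOutNeighbour xt w

  reachWithin4 : Walk D x y → ShortWalk x y 4
  reachWithin4 w with part x ≟ part y
  reachWithin4 w | no x≁y with semicomplete x y x≁y
  ... | inj₁ xy = xy ∷ [] , s≤s z≤n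
  ... | inj₂ yx = ⊥-elim (noShort (yx ∷ []) (s≤s z≤n))
  reachWithin4 []       | yes x∼y = [] , z≤n
  reachWithin4 (xu ∷ w) | yes x∼y = SamePart.fromOutNeighbour x∼y xu w

two≤k : ∀ {k : ℕ} → (k ≡ 2 ⊎ k ≡ 3) → 2 ≤ k
two≤k (inj₁ refl) = s≤s (s≤s z≤n)
two≤k (inj₂ refl) = s≤s (s≤s z≤n)

mainTheorem6 : (n m r : ℕ) → 3 ≤ r →
    (D : ColoredDigraph n m) → (part : Fin n → Fin r) →
    IsSemicompleteMultipartite D r part →
    (k : ℕ) → (k ≡ 2 ⊎ k ≡ 3) →
    (x y : Fin n) →
    HasColoredPath D k x y →
    ((k′ : ℕ) → k′ ≤ k → ¬ HasColoredPath D k′ y x) →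
    DistAtMost D x y 4
mainTheorem6 n m r _ D part S k k∈23 x y (w , _) forbidden =
  shortWalk⇒dist (Multipartite.reachWithin4 D part S x y noShort w)
  where
  open Walks D
  noShort : (v : Walk D y x) → arcCount D v ≤ 2 → ⊥
  noShort v v≤2 = noShortWalk forbidden v (≤-trans v≤2 (two≤k k∈23))
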